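{- Let $G=(K\cup I,E)$ be a split graph and $(V,\mathcal{F})$ the split graph vertex shelling antimatroid defined on $G$. Then for every $i\in I$, $$\mathcal{F}_i=\{\operatorname{fos}(i)\cup H : H\in\operatorname{Flt}(\operatorname{ufs}(i),\prec),\ H\cap K\neq\varnothing\}.$$
   Context: All graphs are finite and simple. A split graph $G=(K\cup I,E)$ has vertex set $V=K\cup I$ partitioned into a clique $K$ and an independent set $I$ (either may be empty), the partition being given. For $S\subseteq V$, $N(S)$ is the set of vertices of $V\setminus S$ adjacent to some vertex of $S$; $N(v)=N(\{v\})$. A vertex is simplicial if its neighbours induce a clique. The split graph vertex shelling antimatroid $(V,\mathcal{F})$ on $G$: $F\subseteq V$ is feasible iff there is an ordering $(f_1,\dots,f_{|F|})$ of $F$ such that each $f_j$ is simplicial in $G\setminus\{f_1,\dots,f_{j-1}\}$. For $i\in I$, $\mathcal{F}_i$ is the family of $i$-feasible sets, i.e. feasible sets $F$ with $i\in N(F)$. Define $\operatorname{fos}(i)=\{k\in K: k\text{ not adjacent to } i\}\cup\{i'\in I: N(i')\not\subseteq N(i)\}$ and $\operatorname{ufs}(i)=V\setminus(\operatorname{fos}(i)\cup\{i\})=\bigl(\{k\in K: k\sim i\}\cup\{i'\in I: N(i')\subseteq N(i)\}\bigr)\setminus\{i\}$. The relation $\prec$ on $K\cup I$ is: $u\prec v$ iff $u\in K$, $v\in I$ and $u$ is adjacent to $v$ (with reflexivity), giving a poset; $(\operatorname{ufs}(i),\prec)$ is its restriction to $\operatorname{ufs}(i)$. A filter of a poset $(X,\le)$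 is a subset $F\subseteq X$ such that $a\in F$, $a\le b$ imply $b\in F$; $\operatorname{Flt}(X,\le)$ is the family of all filters. -}

module Defs where

open import Data.Nat using (ℕ)
open import Data.Fin using (Fin)
open import Data.Fin.Subset using (Subset; _∈_; _∉_; ⁅_⁆; _∪_; ⊥)
open import Data.List using (List; []; _∷_)
import Data.List.Membership.Propositional as L
open import Data.Product using (Σ; ∃; _×_; _,_)
open import Data.Sum using (_⊎_)
open import Data.Unit using (⊤)
open import Relation.Nullary using (¬_)
open import Relation.Binary using (Decidable)
open import Relation.Binary.PropositionalEquality using (_≡_; _≢_)
open import Function.Bundles using (_⇔_)

-- A finite simple split graph on vertex set Fin n, with the partition
-- given: K is the clique part, I = complement of K is the independent part.
record SplitGraph (n : ℕ) : Set₁ where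
  field
    Adj    : Fin n → Fin n → Set
    adj?   : Decidable Adj
    symm   : ∀ {u v} → Adj u v → Adj v u
    irrefl : ∀ {v} → ¬ Adj v v
    K      : Subset n
    clique : ∀ {u v} → u ∈ K → v ∈ K → u ≢ v → Adj u v
    indep  : ∀ {u v} → u ∉ K → v ∉ K → ¬ Adj u v

module _ {n : ℕ} (G : SplitGraph n) where
  open SplitGraph G

  -- v is simplicial in G \ R : v is present and its (present) neighbours form a clique
  Simplicial : Subset n → Fin n → Set
  Simplicial R v = v ∉ R × (∀ u w → u ∉ R → w ∉ R → Adj v u → Adj v w → u ≢ w → Adj u w)

  ShellingFrom : Subset n → List (Fin n) → Set
  ShellingFrom R [] = ⊤
  ShellingFrom R (f ∷ fs) = Simplicial R f × ShellingFrom (R ∪ ⁅ f ⁆) fs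

  Feasible : Subset n → Set
  Feasible F = Σ (List (Fin n)) λ fs → ShellingFrom ⊥ fs × (∀ x → (x ∈ F) ⇔ (x L.∈ fs))

  InNbhd : Fin n → Subset n → Set
  InNbhd v S = v ∉ S × ∃ λ u → u ∈ S × Adj u v

  IFeasible : Fin n → Subset n → Set
  IFeasible i F = Feasible F × InNbhd i F

  NbhdSub : Fin n → Fin n → Set
  NbhdSub u v = ∀ x → Adj u x → Adj v x

  Fos : Fin n → Fin n → Set
  Fos i x = (x ∈ K × ¬ Adj x i) ⊎ (x ∉ K × ¬ NbhdSub x i)

  -- ufs(i) = V \ (fos(i) ∪ {i})
  Ufs : Fin n → Fin n → Set
  Ufs i x = ((x ∈ K × Adj x i) ⊎ (x ∉ K × NbhdSub x i)) × x ≢ i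

  Prec : Fin n → Fin n → Set
  Prec u v = u ≡ v ⊎ (u ∈ K × v ∉ K × Adj u v)

  IsFilterUfs : Fin n → Subset n → Set
  IsFilterUfs i H = (∀ x → x ∈ H → Ufs i x)
                  × (∀ a b → Ufs i a → Ufs i b → a ∈ H → Prec a b → b ∈ H)

module Submission where

-- Two general facts about shelling sequences carry the argument.
-- (1) Survivor lemmas: a vertex s that is never deleted constrains what
--     must be deleted.  If s – a – c is an induced path and a is deleted,
--     then c is deleted (when a goes, s and c cannot both be present);
--     if s – a – b – t is an induced path and a, b are both deleted, then
--     t is deleted.  With s = i and a a clique neighbour of i in F these
--     give fos(i) ⊆ F and the upward closure of F ∩ ufs(i) (⇒ direction).
-- (2) Staged shelling: if the vertices of F carry ranks such that every
--     f ∈ F is simplicial once all lower-ranked vertices of F are deleted,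
--     then F is feasible (delete F rank by rank; within one rank any order
--     works, since simpliciality survives further deletions).  Ranking
--     F ∩ I, then F ∩ K \ N(i), then F ∩ K ∩ N(i) proves ⇐.

open import Defs
open import Data.Nat using (ℕ; zero; suc; _<_; _≟_; z≤n; s≤s)
open import Data.Nat.Properties using (<-irrefl; n<1+n; m<n⇒m<1+n; m≤n⇒m<n∨m≡n)
open import Data.Fin using (Fin) renaming (_≟_ to _≟ᶠ_)
open import Data.Fin.Subset using (Subset; _∈_; _∉_; ⁅_⁆; _∪_) renaming (⊥ to ∅)
open import Data.Fin.Subset.Properties using (_∈?_; ∉⊥; x∈p∪q⁻; x∈p∪q⁺; x∈⁅y⁆⇔x≡y)
open import Data.Fin.Properties using (all?; ¬∀⟶∃¬)
open import Data.Product using (Σ; ∃; _×_; _,_; proj₁; proj₂)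
open import Data.Sum using (_⊎_; inj₁; inj₂)
open import Data.List using (List; []; _∷_; _++_; filter; allFin)
import Data.List.Membership.Propositional as L
open import Data.List.Membership.Propositional.Properties
  using (∈-++⁺ˡ; ∈-++⁺ʳ; ∈-++⁻; ∈-filter⁺; ∈-filter⁻; ∈-allFin)
open import Data.List.Relation.Unary.Any using (here; there)
open import Data.List.Relation.Unary.All using () renaming (lookup to All-lookup)
open import Data.List.Relation.Unary.Unique.Propositional using (Unique)
open import Data.List.Relation.Unary.Unique.Propositional.Properties using (filter⁺; allFin⁺)
open import Data.List.Relation.Unary.AllPairs using (_∷_)
open import Data.Vec using (tabulate)
open import Data.Vec.Properties using (lookup∘tabulate; []=⇒lookup; lookup⇒[]=)
open import Data.Unit using (tt)
open import Function using (_∘_)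
open import Function.Bundles using (_⇔_; mk⇔; Equivalence)
open import Relation.Nullary using (¬_; Dec; yes; no; does; contradiction)
open import Relation.Nullary.Decidable using (dec-true; _×-dec_; _⊎-dec_; _→-dec_; ¬?)
open import Relation.Binary.PropositionalEquality using (_≡_; _≢_; refl; sym; trans; subst)

module SubsetFacts {n : ℕ} where

  ∈-∪⁅⁆⁻ : ∀ {x f : Fin n} {R : Subset n} → x ∈ R ∪ ⁅ f ⁆ → x ∈ R ⊎ x ≡ f
  ∈-∪⁅⁆⁻ {R = R} p with x∈p∪q⁻ R _ p
  ... | inj₁ x∈R = inj₁ x∈R
  ... | inj₂ x∈f = inj₂ (Equivalence.to x∈⁅y⁆⇔x≡y x∈f)

  ∉-∪⁅⁆ : ∀ {x f : Fin n} {R : Subset n} → x ∉ R → x ≢ f → x ∉ R ∪ ⁅ f ⁆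
  ∉-∪⁅⁆ x∉R x≢f p with ∈-∪⁅⁆⁻ p
  ... | inj₁ x∈R = x∉R x∈R
  ... | inj₂ x≡f = x≢f x≡f

  ∈-∪⁅⁆⁺ : ∀ {x f : Fin n} {R : Subset n} → x ∈ R ⊎ x ≡ f → x ∈ R ∪ ⁅ f ⁆
  ∈-∪⁅⁆⁺ (inj₁ x∈R) = x∈p∪q⁺ (inj₁ x∈R)
  ∈-∪⁅⁆⁺ (inj₂ x≡f) = x∈p∪q⁺ (inj₂ (Equivalence.from x∈⁅y⁆⇔x≡y x≡f))

  ⟦_⟧ : {P : Fin n → Set} → (∀ x → Dec (P x)) → Subset n
  ⟦ P? ⟧ = tabulate (does ∘ P?)

  ∈-⟦⟧ : {P : Fin n → Set} (P? : ∀ x → Dec (P x)) {x : Fin n} → x ∈ ⟦ P? ⟧ ⇔ P x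
  ∈-⟦⟧ {P} P? {x} = mk⇔ to from
    where
      to : x ∈ ⟦ P? ⟧ → P x
      to p with P? x | trans (sym (lookup∘tabulate (does ∘ P?) x)) ([]=⇒lookup p)
      ... | yes px | _ = px
      ... | no _   | ()
      from : P x → x ∈ ⟦ P? ⟧
      from px = lookup⇒[]= x _ (trans (lookup∘tabulate (does ∘ P?) x) (dec-true (P? x) px))

  deleteAll : Subset n → List (Fin n) → Subset n
  deleteAll R []       = R
  deleteAll R (f ∷ fs) = deleteAll (R ∪ ⁅ f ⁆) fs

  ∈-deleteAll⁻ : ∀ {x} R fs → x ∈ deleteAll R fs → x ∈ R ⊎ x L.∈ fs
  ∈-deleteAll⁻ R [] p = inj₁ p
  ∈-deleteAll⁻ R (f ∷ fs) p with ∈-deleteAll⁻ (R ∪ ⁅ f ⁆) fs p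
  ... | inj₂ x∈fs = inj₂ (there x∈fs)
  ... | inj₁ x∈R' with ∈-∪⁅⁆⁻ x∈R'
  ...   | inj₁ x∈R = inj₁ x∈R
  ...   | inj₂ x≡f = inj₂ (here x≡f)

  ∈-deleteAll⁺ : ∀ {x} R fs → x ∈ R ⊎ x L.∈ fs → x ∈ deleteAll R fs
  ∈-deleteAll⁺ R [] (inj₁ x∈R) = x∈R
  ∈-deleteAll⁺ R (f ∷ fs) (inj₁ x∈R) = ∈-deleteAll⁺ (R ∪ ⁅ f ⁆) fs (inj₁ (∈-∪⁅⁆⁺ (inj₁ x∈R)))
  ∈-deleteAll⁺ R (f ∷ fs) (inj₂ (here x≡f)) = ∈-deleteAll⁺ (R ∪ ⁅ f ⁆) fs (inj₁ (∈-∪⁅⁆⁺ (inj₂ x≡f)))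
  ∈-deleteAll⁺ R (f ∷ fs) (inj₂ (there x∈fs)) = ∈-deleteAll⁺ (R ∪ ⁅ f ⁆) fs (inj₂ x∈fs)

open SubsetFacts

module SplitGraphFacts {n : ℕ} (G : SplitGraph n) where
  open SplitGraph G

  NbhdSub? : ∀ x y → Dec (NbhdSub G x y)
  NbhdSub? x y = all? (λ z → adj? x z →-dec adj? y z)

  nbhd-witness : ∀ {x y} → ¬ NbhdSub G x y → ∃ λ z → Adj x z × ¬ Adj y z
  nbhd-witness {x} {y} N⊈ with ¬∀⟶∃¬ n _ (λ z → adj? x z →-dec adj? y z) N⊈
  ... | z , ¬x→y with adj? x z
  ...   | yes xz = z , xz , λ yz → ¬x→y (λ _ → yz)
  ...   | no ¬xz = contradiction (λ xz → contradiction xz ¬xz) ¬x→y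

  nbr-of-I-in-K : ∀ {x y} → x ∉ K → Adj x y → y ∈ K
  nbr-of-I-in-K {y = y} x∉K xy with y ∈? K
  ... | yes y∈K = y∈K
  ... | no y∉K  = contradiction xy (indep x∉K y∉K)

  K≢I : ∀ {x y} → x ∈ K → y ∉ K → x ≢ y
  K≢I x∈K y∉K refl = y∉K x∈K

  simplicial-in-clique : ∀ {R f} (C : Fin n → Set) → (∀ {u w} → C u → C w → u ≢ w → Adj u w) →
    f ∉ R → (∀ u → u ∉ R → Adj f u → C u) → Simplicial G R f
  simplicial-in-clique C clique-C f∉R nbrs-in-C =
    f∉R , λ u w u∉R w∉R fu fw u≢w → clique-C (nbrs-in-C u u∉R fu) (nbrs-in-C w w∉R fw) u≢w

  simplicial-mono : ∀ {R R' f} → (∀ y → y ∈ R → y ∈ R') → f ∉ R' → Simplicial G R f → Simplicial G R' f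
  simplicial-mono R⊆R' f∉R' (_ , simp) =
    f∉R' , λ u w u∉R' w∉R' → simp u w (u∉R' ∘ R⊆R' u) (w∉R' ∘ R⊆R' w)

  shelling-avoids : ∀ {R fs x} → ShellingFrom G R fs → x L.∈ fs → x ∉ R
  shelling-avoids ((f∉R , _) , _) (here refl) = f∉R
  shelling-avoids (_ , sh) (there x∈fs) x∈R = shelling-avoids sh x∈fs (∈-∪⁅⁆⁺ (inj₁ x∈R))

  -- Survivor lemma, induced path s – a – c: if s is never deleted and a is
  -- deleted, then c is deleted (otherwise s, c would be present non-adjacent
  -- neighbours of a when a is deleted).
  survivor-path₃ : ∀ {R fs s a c} → ShellingFrom G R fs → s ∉ R → ¬ s L.∈ fs → a L.∈ fs →
    Adj s a → Adj a c → ¬ Adj s c → s ≢ c → c ∉ R → c L.∈ fs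
  survivor-path₃ {fs = f ∷ fs} {c = c} sh s∉R s∉fs a∈fs sa ac ¬sc s≢c c∉R with f ≟ᶠ c
  ... | yes refl = here refl
  survivor-path₃ ((_ , simp) , _) s∉R s∉fs (here refl) sa ac ¬sc s≢c c∉R | no _ =
    contradiction (simp _ _ s∉R c∉R (symm sa) ac s≢c) ¬sc
  survivor-path₃ (_ , sh) s∉R s∉fs (there a∈fs) sa ac ¬sc s≢c c∉R | no f≢c =
    there (survivor-path₃ sh (∉-∪⁅⁆ s∉R (s∉fs ∘ here)) (s∉fs ∘ there) a∈fs sa ac ¬sc s≢c
             (∉-∪⁅⁆ c∉R (f≢c ∘ sym)))

  -- Whichever of a, b goes first sees
  -- two present non-adjacent neighbours otherwise.
  survivor-path₄ : ∀ {R fs s a b t} → ShellingFrom G R fs → s ∉ R → ¬ s L.∈ fs →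
    a L.∈ fs → b L.∈ fs → Adj s a → Adj a b → Adj b t → ¬ Adj s b → ¬ Adj a t → a ≢ t →
    t ∉ R → t L.∈ fs
  survivor-path₄ {fs = f ∷ fs} {t = t} sh s∉R s∉fs a∈fs b∈fs sa ab bt ¬sb ¬at a≢t t∉R with f ≟ᶠ t
  ... | yes refl = here refl
  survivor-path₄ sh@((_ , simp) , _) s∉R s∉fs (here refl) b∈fs sa ab bt ¬sb ¬at a≢t t∉R | no _ =
    contradiction (simp _ _ s∉R (shelling-avoids sh b∈fs) (symm sa) ab (λ { refl → s∉fs b∈fs })) ¬sb
  survivor-path₄ sh@((_ , simp) , _) s∉R s∉fs a∈fs (here refl) sa ab bt ¬sb ¬at a≢t t∉R | no _ =
    contradiction (simp _ _ (shelling-avoids sh a∈fs) t∉R (symm ab) bt a≢t) ¬at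
  survivor-path₄ (_ , sh) s∉R s∉fs (there a∈fs) (there b∈fs) sa ab bt ¬sb ¬at a≢t t∉R | no f≢t =
    there (survivor-path₄ sh (∉-∪⁅⁆ s∉R (s∉fs ∘ here)) (s∉fs ∘ there) a∈fs b∈fs
             sa ab bt ¬sb ¬at a≢t (∉-∪⁅⁆ t∉R (f≢t ∘ sym)))

  shelling-++ : ∀ {R} xs {ys} → ShellingFrom G R xs → ShellingFrom G (deleteAll R xs) ys →
    ShellingFrom G R (xs ++ ys)
  shelling-++ []       _          sh-ys = sh-ys
  shelling-++ (x ∷ xs) (s , sh-xs) sh-ys = s , shelling-++ xs sh-xs sh-ys

  shelling-batch : ∀ {R ys} → Unique ys → (∀ y → y L.∈ ys → Simplicial G R y) → ShellingFrom G R ys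
  shelling-batch {ys = []} _ _ = tt
  shelling-batch {ys = y ∷ ys} (y∉ys ∷ uniq) simp =
    simp y (here refl) , shelling-batch uniq λ z z∈ys →
      simplicial-mono (λ _ → ∈-∪⁅⁆⁺ ∘ inj₁)
        (∉-∪⁅⁆ (proj₁ (simp z (there z∈ys))) (All-lookup y∉ys z∈ys ∘ sym))
        (simp z (there z∈ys))

  module Staged (F : Subset n) (rank : Fin n → ℕ) where

    stage : ℕ → List (Fin n)
    stage r = filter (λ y → (y ∈? F) ×-dec (rank y ≟ r)) (allFin n)

    below : ℕ → List (Fin n)
    below zero    = []
    below (suc r) = below r ++ stage r

    ∈-below⁻ : ∀ {y} r → y L.∈ below r → y ∈ F × rank y < r
    ∈-below⁻ (suc r) y∈ with ∈-++⁻ (below r) y∈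
    ... | inj₁ y∈below = let y∈F , lt = ∈-below⁻ r y∈below in y∈F , m<n⇒m<1+n lt
    ... | inj₂ y∈stage with proj₂ (∈-filter⁻ _ {xs = allFin n} y∈stage)
    ...   | y∈F , refl = y∈F , n<1+n _

    ∈-below⁺ : ∀ {y} r → y ∈ F → rank y < r → y L.∈ below r
    ∈-below⁺ {y} (suc r) y∈F (s≤s ry≤r) with m≤n⇒m<n∨m≡n ry≤r
    ... | inj₁ lt = ∈-++⁺ˡ (∈-below⁺ r y∈F lt)
    ... | inj₂ eq = ∈-++⁺ʳ (below r) (∈-filter⁺ _ (∈-allFin y) (y∈F , eq))

    Shellable : Set
    Shellable = ∀ f → f ∈ F → ∀ R → (∀ y → y ∈ F → rank y < rank f → y ∈ R) → f ∉ R → Simplicial G R f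

    stage-simplicial : Shellable → ∀ r y → y L.∈ stage r → Simplicial G (deleteAll ∅ (below r)) y
    stage-simplicial shellable r y y∈stage with proj₂ (∈-filter⁻ _ {xs = allFin n} y∈stage)
    ... | y∈F , refl = shellable y y∈F _ lower-deleted y-present
      where
        lower-deleted : ∀ z → z ∈ F → rank z < rank y → z ∈ deleteAll ∅ (below (rank y))
        lower-deleted z z∈F lt = ∈-deleteAll⁺ ∅ _ (inj₂ (∈-below⁺ (rank y) z∈F lt))
        y-present : y ∉ deleteAll ∅ (below (rank y))
        y-present y∈ with ∈-deleteAll⁻ ∅ (below (rank y)) y∈
        ... | inj₁ y∈∅     = ∉⊥ y∈∅
        ... | inj₂ y∈below = <-irrefl refl (proj₂ (∈-below⁻ (rank y) y∈below))

    shelling-below : Shellable → ∀ r → ShellingFrom G ∅ (below r)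
    shelling-below shellable zero    = tt
    shelling-below shellable (suc r) =
      shelling-++ (below r) (shelling-below shellable r)
        (shelling-batch (filter⁺ _ (allFin⁺ n)) (stage-simplicial shellable r))

    staged-feasible : ∀ m → (∀ y → rank y < m) → Shellable → Feasible G F
    staged-feasible m bounded shellable =
      below m , shelling-below shellable m ,
      λ x → mk⇔ (λ x∈F → ∈-below⁺ m x∈F (bounded x)) (proj₁ ∘ ∈-below⁻ m)

module Theorem9 {n : ℕ} (G : SplitGraph n) (i : Fin n) (i∉K : i ∉ SplitGraph.K G) where
  open SplitGraph G
  open SplitGraphFacts G

  Ufs? : ∀ x → Dec (Ufs G i x)
  Ufs? x = (((x ∈? K) ×-dec adj? x i) ⊎-dec (¬? (x ∈? K) ×-dec NbhdSub? x i)) ×-dec ¬? (x ≟ᶠ i)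

  classify : ∀ x → Fos G i x ⊎ Ufs G i x ⊎ x ≡ i
  classify x with x ≟ᶠ i
  ... | yes x≡i = inj₂ (inj₂ x≡i)
  ... | no x≢i with x ∈? K
  ...   | yes x∈K with adj? x i
  ...     | yes xi  = inj₂ (inj₁ (inj₁ (x∈K , xi) , x≢i))
  ...     | no ¬xi  = inj₁ (inj₁ (x∈K , ¬xi))
  classify x | no x≢i | no x∉K with NbhdSub? x i
  ...   | yes N⊆ = inj₂ (inj₁ (inj₂ (x∉K , N⊆) , x≢i))
  ...   | no N⊈  = inj₁ (inj₂ (x∉K , N⊈))

  i∉fos : ¬ Fos G i i
  i∉fos (inj₁ (i∈K , _)) = i∉K i∈K
  i∉fos (inj₂ (_ , N⊈))  = N⊈ (λ _ ii' → ii')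

  ufs-K⇒adj : ∀ {x} → Ufs G i x → x ∈ K → Adj x i
  ufs-K⇒adj (inj₁ (_ , xi) , _)   _   = xi
  ufs-K⇒adj (inj₂ (x∉K , _) , _) x∈K = contradiction x∈K x∉K

  -- Deletion stage used for ⇐: first I, then K \ N(i), then K ∩ N(i).
  rank : Fin n → ℕ
  rank x with x ∈? K | adj? x i
  ... | no _  | _     = 0
  ... | yes _ | no _  = 1
  ... | yes _ | yes _ = 2

  rank-I : ∀ {x} → x ∉ K → rank x ≡ 0
  rank-I {x} x∉K with x ∈? K | adj? x i
  ... | no _    | _ = refl
  ... | yes x∈K | _ = contradiction x∈K x∉K

  rank-K∖N : ∀ {x} → x ∈ K → ¬ Adj x i → rank x ≡ 1
  rank-K∖N {x} x∈K ¬xi with x ∈? K | adj? x i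
  ... | no x∉K | _     = contradiction x∈K x∉K
  ... | yes _  | no _  = refl
  ... | yes _  | yes xi = contradiction xi ¬xi

  rank<3 : ∀ x → rank x < 3
  rank<3 x with x ∈? K | adj? x i
  ... | no _  | _     = s≤s z≤n
  ... | yes _ | no _  = s≤s (s≤s z≤n)
  ... | yes _ | yes _ = s≤s (s≤s (s≤s z≤n))

  K∩N∪i : Fin n → Set
  K∩N∪i u = (u ∈ K × Adj u i) ⊎ u ≡ i

  K∩N∪i-clique : ∀ {u w} → K∩N∪i u → K∩N∪i w → u ≢ w → Adj u w
  K∩N∪i-clique (inj₁ (u∈K , _)) (inj₁ (w∈K , _)) u≢w = clique u∈K w∈K u≢w
  K∩N∪i-clique (inj₁ (_ , ui))  (inj₂ refl)       _   = ui
  K∩N∪i-clique (inj₂ refl)      (inj₁ (_ , wi))   _   = symm wi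
  K∩N∪i-clique (inj₂ refl)      (inj₂ refl)       u≢w = contradiction refl u≢w

  -- A clique vertex x ≁ i follows from the
  -- path i – u – x; an independent x with a neighbour k ∉ N(i) from the path
  -- i – u – x, or, when u ≁ x, from the path i – u – k – x.
  fos-deleted : ∀ {fs u x} → ShellingFrom G ∅ fs → ¬ i L.∈ fs → u L.∈ fs → Adj u i →
    Fos G i x → x L.∈ fs
  fos-deleted {u = u} {x} sh i∉fs u∈fs ui (inj₁ (x∈K , ¬xi)) =
    survivor-path₃ sh ∉⊥ i∉fs u∈fs (symm ui) (clique u∈K x∈K u≢x) (¬xi ∘ symm) (K≢I x∈K i∉K ∘ sym) ∉⊥
    where
      u∈K : u ∈ K
      u∈K = nbr-of-I-in-K i∉K (symm ui)
      u≢x : u ≢ x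
      u≢x refl = ¬xi ui
  fos-deleted {fs} {u} {x} sh i∉fs u∈fs ui (inj₂ (x∉K , N⊈)) with nbhd-witness N⊈ | adj? u x
  ... | _ , _ , _ | yes ux = survivor-path₃ sh ∉⊥ i∉fs u∈fs (symm ui) ux (indep i∉K x∉K) i≢x ∉⊥
    where
      i≢x : i ≢ x
      i≢x refl = i∉fos (inj₂ (x∉K , N⊈))
  ... | k , xk , ¬ik | no ¬ux =
    survivor-path₄ sh ∉⊥ i∉fs u∈fs k∈fs (symm ui) (clique u∈K k∈K u≢k) (symm xk) ¬ik ¬ux
      (K≢I u∈K x∉K) ∉⊥
    where
      u∈K : u ∈ K
      u∈K = nbr-of-I-in-K i∉K (symm ui)
      k∈K : k ∈ K
      k∈K = nbr-of-I-in-K x∉K xk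
      u≢k : u ≢ k
      u≢k refl = ¬ik (symm ui)
      k∈fs : k L.∈ fs
      k∈fs = fos-deleted sh i∉fs u∈fs ui (inj₁ (k∈K , ¬ik ∘ symm))

  Decomposition : Subset n → Set
  Decomposition F = Σ (Subset n) λ H → IsFilterUfs G i H
                  × (∃ λ k → k ∈ H × k ∈ K)
                  × (∀ x → (x ∈ F) ⇔ (Fos G i x ⊎ x ∈ H))

  -- ⇒: take H = F ∩ ufs(i).  It is upward closed because a deleted clique
  -- neighbour a of the surviving i forces its independent neighbours out
  -- (path i – a – b), and fos(i) ⊆ F by fos-deleted.
  ifeasible⇒decomposition : ∀ F → IFeasible G i F → Decomposition F
  ifeasible⇒decomposition F ((fs , sh , F⇔fs) , i∉F , u , u∈F , ui) =
    H , (H⊆ufs , H-upward) , (u , u∈H , u∈K) , λ x → mk⇔ (split x) (join x)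
    where
      F∩Ufs? : ∀ x → Dec (x ∈ F × Ufs G i x)
      F∩Ufs? x = (x ∈? F) ×-dec Ufs? x
      H : Subset n
      H = ⟦ F∩Ufs? ⟧
      ∈H⁺ : ∀ {x} → x ∈ F → Ufs G i x → x ∈ H
      ∈H⁺ x∈F ux = Equivalence.from (∈-⟦⟧ F∩Ufs?) (x∈F , ux)
      toList : ∀ {x} → x ∈ F → x L.∈ fs
      toList {x} = Equivalence.to (F⇔fs x)
      fromList : ∀ {x} → x L.∈ fs → x ∈ F
      fromList {x} = Equivalence.from (F⇔fs x)
      i∉fs : ¬ i L.∈ fs
      i∉fs = i∉F ∘ fromList
      u∈K : u ∈ K
      u∈K = nbr-of-I-in-K i∉K (symm ui)
      u∈H : u ∈ H
      u∈H = ∈H⁺ u∈F (inj₁ (u∈K , ui) , λ { refl → i∉F u∈F })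
      H⊆ufs : ∀ x → x ∈ H → Ufs G i x
      H⊆ufs x = proj₂ ∘ Equivalence.to (∈-⟦⟧ F∩Ufs?)
      H-upward : ∀ a b → Ufs G i a → Ufs G i b → a ∈ H → Prec G a b → b ∈ H
      H-upward a b ua ub a∈H (inj₁ refl) = a∈H
      H-upward a b ua ub a∈H (inj₂ (a∈K , b∉K , ab)) =
        ∈H⁺ (fromList (survivor-path₃ sh ∉⊥ i∉fs a∈fs (symm (ufs-K⇒adj ua a∈K)) ab
                         (indep i∉K b∉K) (proj₂ ub ∘ sym) ∉⊥)) ub
        where
          a∈fs : a L.∈ fs
          a∈fs = toList (proj₁ (Equivalence.to (∈-⟦⟧ F∩Ufs?) a∈H))
      split : ∀ x → x ∈ F → Fos G i x ⊎ x ∈ H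
      split x x∈F with classify x
      ... | inj₁ fos-x         = inj₁ fos-x
      ... | inj₂ (inj₁ ufs-x)  = inj₂ (∈H⁺ x∈F ufs-x)
      ... | inj₂ (inj₂ refl)   = contradiction x∈F i∉F
      join : ∀ x → Fos G i x ⊎ x ∈ H → x ∈ F
      join x (inj₁ fos-x) = fromList (fos-deleted sh i∉fs (toList u∈F) ui fos-x)
      join x (inj₂ x∈H)   = proj₁ (Equivalence.to (∈-⟦⟧ F∩Ufs?) x∈H)

  -- ⇐: delete F ∩ I, then F ∩ K \ N(i), then F ∩ K ∩ N(i).  An independent
  -- vertex is always simplicial; once F ∩ I is gone, a clique vertex f has
  -- only clique neighbours left (its independent neighbours are in fos(i)
  -- or, if f ∈ N(i), in H by upward closure), apart from i itself; and once
  -- also K \ N(i) ⊆ fos(i) is gone, the clique neighbours of f ∈ N(i) lie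
  -- in N(i).
  module FromDecomposition (F H : Subset n) (H⊆ufs : ∀ x → x ∈ H → Ufs G i x)
    (H-upward : ∀ a b → Ufs G i a → Ufs G i b → a ∈ H → Prec G a b → b ∈ H)
    (F⇔fos∪H : ∀ x → (x ∈ F) ⇔ (Fos G i x ⊎ x ∈ H)) where

    ∈F⁺ : ∀ {x} → Fos G i x ⊎ x ∈ H → x ∈ F
    ∈F⁺ {x} = Equivalence.from (F⇔fos∪H x)

    i∉F : i ∉ F
    i∉F i∈F with Equivalence.to (F⇔fos∪H i) i∈F
    ... | inj₁ fos-i = i∉fos fos-i
    ... | inj₂ i∈H   = proj₂ (H⊆ufs i i∈H) refl

    I-nbr-in-F : ∀ {f u} → f ∈ F → f ∈ K → u ∉ K → Adj f u → u ≢ i → u ∈ F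
    I-nbr-in-F {f} {u} f∈F f∈K u∉K fu u≢i with NbhdSub? u i
    ... | no N⊈ = ∈F⁺ (inj₁ (inj₂ (u∉K , N⊈)))
    ... | yes N⊆ with Equivalence.to (F⇔fos∪H f) f∈F
    ...   | inj₂ f∈H = ∈F⁺ (inj₂ (H-upward f u (H⊆ufs f f∈H) ufs-u f∈H (inj₂ (f∈K , u∉K , fu))))
      where
        ufs-u : Ufs G i u
        ufs-u = inj₂ (u∉K , N⊆) , u≢i
    ...   | inj₁ (inj₁ (_ , ¬fi)) = contradiction (symm (N⊆ f (symm fu))) ¬fi
    ...   | inj₁ (inj₂ (f∉K , _)) = contradiction f∈K f∉K

    -- Each f ∈ F is simplicial once the lower-ranked part of F is deleted;
    -- a present neighbour of the wrong kind would be a lower-ranked vertex of F.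
    shellable : Staged.Shellable F rank
    shellable f f∈F R lower f∉R with f ∈? K | adj? f i
    ... | no f∉K | _ = simplicial-in-clique (_∈ K) clique f∉R (λ u _ fu → nbr-of-I-in-K f∉K fu)
    ... | yes f∈K | no ¬fi = simplicial-in-clique (_∈ K) clique f∉R K-nbr
      where
        K-nbr : ∀ u → u ∉ R → Adj f u → u ∈ K
        K-nbr u u∉R fu with u ∈? K
        ... | yes u∈K = u∈K
        ... | no u∉K  = contradiction (lower u (I-nbr-in-F f∈F f∈K u∉K fu λ { refl → ¬fi fu })
                          (subst (_< 1) (sym (rank-I u∉K)) (s≤s z≤n))) u∉R
    ... | yes f∈K | yes fi = simplicial-in-clique K∩N∪i K∩N∪i-clique f∉R K∩N∪i-nbr
      where
        K∩N∪i-nbr : ∀ u → u ∉ R → Adj f u → K∩N∪i u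
        K∩N∪i-nbr u u∉R fu with u ∈? K | u ≟ᶠ i
        ... | _ | yes u≡i = inj₂ u≡i
        ... | yes u∈K | no _ with adj? u i
        ...   | yes ui  = inj₁ (u∈K , ui)
        ...   | no ¬ui  = contradiction (lower u (∈F⁺ (inj₁ (inj₁ (u∈K , ¬ui))))
                            (subst (_< 2) (sym (rank-K∖N u∈K ¬ui)) (s≤s (s≤s z≤n)))) u∉R
        K∩N∪i-nbr u u∉R fu | no u∉K | no u≢i =
          contradiction (lower u (I-nbr-in-F f∈F f∈K u∉K fu u≢i)
            (subst (_< 2) (sym (rank-I u∉K)) (s≤s z≤n))) u∉R

  decomposition⇒ifeasible : ∀ F → Decomposition F → IFeasible G i F
  decomposition⇒ifeasible F (H , (H⊆ufs , H-upward) , (k , k∈H , k∈K) , F⇔fos∪H) =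
    Staged.staged-feasible F rank 3 rank<3 shellable , i∉F , k , ∈F⁺ (inj₂ k∈H) ,
    ufs-K⇒adj (H⊆ufs k k∈H) k∈K
    where open FromDecomposition F H H⊆ufs H-upward F⇔fos∪H

mainTheorem9 : ∀ {n : ℕ} (G : SplitGraph n) (i : Fin n) → i ∉ SplitGraph.K G →
    ∀ (F : Subset n) →
    IFeasible G i F ⇔
    (Σ (Subset n) λ H → IsFilterUfs G i H
    × (∃ λ k → k ∈ H × k ∈ SplitGraph.K G)
    × (∀ x → (x ∈ F) ⇔ (Fos G i x ⊎ x ∈ H)))
mainTheorem9 G i i∉K F =
  mk⇔ (ifeasible⇒decomposition F) (decomposition⇒ifeasible F)
  where open Theorem9 G i i∉K
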